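{- Let $\mathcal{A}$ be a set of games that is conjugate closed and hereditary, and let $E_L(\mathcal{A})$ be the set of Left ends in $\mathcal{A}$. Then $\mathcal{D}(\mathcal{A})=\mathcal{D}(E_L(\mathcal{A}))$.
   Context: All games are short partizan combinatorial game forms $G=\{G^{\mathcal L}\mid G^{\mathcal R}\}$ (finite sets of Left and Right options, defined recursively); $G+H$ is the disjunctive sum. A Left end is a game with no Left option. The conjugate $\overline{G}$ of $G$ is obtained by interchanging the roles of Left and Right recursively (i.e. $\overline{G}=\{\overline{G^{R}}\mid \overline{G^{L}}\}$). A set of games $\mathcal{A}$ is hereditary if every option of every element of $\mathcal{A}$ lies in $\mathcal{A}$, and conjugate closed if $\overline{G}\in\mathcal{A}$ whenever $G\in\mathcal{A}$. A universe is a set of games $\mathcal{U}$ such that for all $G,H\in\mathcal{U}$: $G+H\in\mathcal{U}$; every option of $G$ is in $\mathcal{U}$; $\overline{G}\in\mathcal{U}$; and whenever $\mathcal{G},\mathcal{H}$ are non-empty finite subsets of $\mathcal{U}$, the game $\{\mathcal{G}\mid\mathcal{H}\}$ is in $\mathcal{U}$. For a set of games $\mathcal{A}$, its universal closure $\mathcal{D}(\mathcal{A})$ is the smallest universe (under inclusion) containing $\mathcal{A}$ (the intersection of all universes containing $\mathcal{A}$). Equality of sets here means equality of sets of game forms. -}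

module Defs where

open import Level using (Level; 0ℓ) renaming (suc to lsuc)
open import Data.List using (List; []; _∷_; _++_)
open import Data.List.Relation.Unary.All using (All)
open import Data.List.Membership.Propositional using (_∈_)
open import Data.Product using (_×_)
open import Relation.Binary.PropositionalEquality using (_≡_; _≢_)

-- Short partizan game forms: finite (listed) Left and Right options.
data Game : Set where
  ⟨_∣_⟩ : List Game → List Game → Game

leftOpts : Game → List Game
leftOpts ⟨ L ∣ R ⟩ = L

rightOpts : Game → List Game
rightOpts ⟨ L ∣ R ⟩ = R

data IsOption (G' : Game) : Game → Set where
  left  : ∀ {L R} → G' ∈ L → IsOption G' ⟨ L ∣ R ⟩
  right : ∀ {L R} → G' ∈ R → IsOption G' ⟨ L ∣ R ⟩

mutual
  conj : Game → Game
  conj ⟨ L ∣ R ⟩ = ⟨ conjList R ∣ conjList L ⟩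

  conjList : List Game → List Game
  conjList []       = []
  conjList (g ∷ gs) = conj g ∷ conjList gs

-- Disjunctive sum: G + H = { G^L + H , G + H^L | G^R + H , G + H^R }.
mutual
  infixl 6 _+_
  _+_ : Game → Game → Game
  ⟨ GL ∣ GR ⟩ + ⟨ HL ∣ HR ⟩ =
    ⟨ addL GL ⟨ HL ∣ HR ⟩ ++ addR ⟨ GL ∣ GR ⟩ HL
    ∣ addL GR ⟨ HL ∣ HR ⟩ ++ addR ⟨ GL ∣ GR ⟩ HR ⟩

  addL : List Game → Game → List Game
  addL []       H = []
  addL (g ∷ gs) H = (g + H) ∷ addL gs H

  addR : Game → List Game → List Game
  addR G []       = []
  addR G (h ∷ hs) = (G + h) ∷ addR G hs

GameSet : Set₁
GameSet = Game → Set

_⊆_ : ∀ {ℓ₁ ℓ₂} → (Game → Set ℓ₁) → (Game → Set ℓ₂) → Set _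
A ⊆ B = ∀ {G} → A G → B G

_≐_ : ∀ {ℓ₁ ℓ₂} → (Game → Set ℓ₁) → (Game → Set ℓ₂) → Set _
A ≐ B = (A ⊆ B) × (B ⊆ A)

Hereditary : GameSet → Set
Hereditary A = ∀ {G G'} → A G → IsOption G' G → A G'

ConjugateClosed : GameSet → Set
ConjugateClosed A = ∀ {G} → A G → A (conj G)

IsUniverse : GameSet → Set
IsUniverse U =
    (∀ {G H} → U G → U H → U (G + H))
  × Hereditary U
  × ConjugateClosed U
  × (∀ (𝒢 ℋ : List Game) → 𝒢 ≢ [] → ℋ ≢ [] → All U 𝒢 → All U ℋ → U ⟨ 𝒢 ∣ ℋ ⟩)

𝒟 : GameSet → Game → Set₁
𝒟 A G = (U : GameSet) → IsUniverse U → A ⊆ U → U G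

IsLeftEnd : Game → Set
IsLeftEnd G = leftOpts G ≡ []

E-L : GameSet → GameSet
E-L A G = A G × IsLeftEnd G

{-# OPTIONS --safe #-}
-- A game of A with options on both sides is the form {𝒢 ∣ ℋ} of its options, which lie in A
-- by heredity; a Left end is in E_L(A); and a Right end is the conjugate of a Left end of A.
-- So, by induction on game forms, every universe containing E_L(A) already contains A.
module Submission where

open import Defs
open import Data.List using (List; []; _∷_)
open import Data.List.Relation.Unary.All using (All; []; _∷_)
open import Data.List.Membership.Propositional using (_∈_)
open import Data.List.Relation.Unary.Any using (here; there)
open import Data.Product using (_,_; proj₁)
open import Relation.Binary.PropositionalEquality using (_≡_; _≢_; refl; cong₂; subst)

mutual
  conj-involutive : (G : Game) → conj (conj G) ≡ G
  conj-involutive ⟨ L ∣ R ⟩ = cong₂ ⟨_∣_⟩ (conjList-involutive L) (conjList-involutive R)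

  conjList-involutive : (Gs : List Game) → conjList (conjList Gs) ≡ Gs
  conjList-involutive []       = refl
  conjList-involutive (G ∷ Gs) = cong₂ _∷_ (conj-involutive G) (conjList-involutive Gs)

ClosedUnderForms : GameSet → Set
ClosedUnderForms U =
  ∀ (𝒢 ℋ : List Game) → 𝒢 ≢ [] → ℋ ≢ [] → All U 𝒢 → All U ℋ → U ⟨ 𝒢 ∣ ℋ ⟩

IsUniverse⇒ConjugateClosed : ∀ {U} → IsUniverse U → ConjugateClosed U
IsUniverse⇒ConjugateClosed (_ , _ , conjU , _) = conjU

IsUniverse⇒ClosedUnderForms : ∀ {U} → IsUniverse U → ClosedUnderForms U
IsUniverse⇒ClosedUnderForms (_ , _ , _ , formsU) = formsU

module _ {A U : GameSet} (conjA : ConjugateClosed A) (herA : Hereditary A)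
         (conjU : ConjugateClosed U) (formsU : ClosedUnderForms U)
         (E-L-A⊆U : E-L A ⊆ U) where

  mutual
    E-L⊆⇒⊆ : (G : Game) → A G → U G
    E-L⊆⇒⊆ ⟨ [] ∣ R ⟩ G∈A = E-L-A⊆U (G∈A , refl)
    E-L⊆⇒⊆ G@(⟨ _ ∷ _ ∣ [] ⟩) G∈A =
      subst U (conj-involutive G) (conjU (E-L-A⊆U (conjA G∈A , refl)))
    E-L⊆⇒⊆ ⟨ L@(_ ∷ _) ∣ R@(_ ∷ _) ⟩ G∈A =
      formsU L R (λ ()) (λ ())
        (E-L⊆⇒⊆-All L (λ G'∈L → herA G∈A (left G'∈L)))
        (E-L⊆⇒⊆-All R (λ G'∈R → herA G∈A (right G'∈R)))

    E-L⊆⇒⊆-All : (Gs : List Game) → (∀ {G} → G ∈ Gs → A G) → All U Gs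
    E-L⊆⇒⊆-All []       Gs⊆A = []
    E-L⊆⇒⊆-All (G ∷ Gs) Gs⊆A =
      E-L⊆⇒⊆ G (Gs⊆A (here refl)) ∷ E-L⊆⇒⊆-All Gs (λ G'∈Gs → Gs⊆A (there G'∈Gs))

𝒟-⊆ : ∀ {A B : GameSet} → (∀ U → IsUniverse U → B ⊆ U → A ⊆ U) → 𝒟 A ⊆ 𝒟 B
𝒟-⊆ B⊆U⇒A⊆U G∈𝒟A U isU B⊆U = G∈𝒟A U isU (B⊆U⇒A⊆U U isU B⊆U)

𝒟-mono : ∀ {A B : GameSet} → A ⊆ B → 𝒟 A ⊆ 𝒟 B
𝒟-mono A⊆B = 𝒟-⊆ (λ _ _ B⊆U G∈A → B⊆U (A⊆B G∈A))

mainTheorem1 : (A : GameSet) → ConjugateClosed A → Hereditary A →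
                   𝒟 A ≐ 𝒟 (E-L A)
mainTheorem1 A conjA herA =
    𝒟-⊆ (λ U isU E-L-A⊆U {G} →
           E-L⊆⇒⊆ conjA herA (IsUniverse⇒ConjugateClosed isU)
                  (IsUniverse⇒ClosedUnderForms isU) E-L-A⊆U G)
  , 𝒟-mono proj₁
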